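{- Let $p$ be an odd prime, $k\ge 2$ an integer, and $c:\mathbb{Z}_p\to\{R,G,B\}$ an exact $3$-coloring that is rainbow-free for $x-y=z^k$. Then for every nonzero $a\in\mathbb{Z}_p$, the color $c(a)$ is $a^k$-dominant.
   Context: An exact $3$-coloring is a surjective map onto $\{R,G,B\}$. $c$ is rainbow-free for $x-y=z^k$ if there is no triple $(a_1,a_2,a_3)\in\mathbb{Z}_p^3$ with $a_1-a_2\equiv a_3^k\pmod p$ and $c(a_1),c(a_2),c(a_3)$ pairwise distinct. For nonzero $a\in\mathbb{Z}_p$, an $a^k$-string of length $\ell$ at position $ia^k$ is the set $\{ia^k,(i+1)a^k,\dots,(i+\ell-1)a^k\}\subseteq\mathbb{Z}_p$ (with $i,\ell\in\mathbb{Z}_p$, computed mod $p$); it is bichromatic if it contains exactly two colors. A color is $a^k$-dominant if every bichromatic $a^k$-string contains an element of that color. -}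

module Defs where

open import Data.Nat using (ℕ; zero; suc; _+_; _*_; _^_; _<_; _≤_; NonZero)
open import Data.Nat.DivMod using (_%_)
open import Data.Fin using (Fin; toℕ)
open import Data.Product using (Σ; _×_; _,_; ∃; ∃-syntax)
open import Relation.Binary.PropositionalEquality using (_≡_; _≢_)
open import Relation.Nullary using (¬_)

data Colour : Set where
  R G B : Colour

-- Z_p is represented by Fin p; arithmetic is done on representatives % p.
module _ (p : ℕ) .{{_ : NonZero p}} where

  -- subtraction a1 - a2 % p, computed as a1 + (p - a2) % p.
  -- We avoid subtraction: a1 - a2 ≡ a3^k  iff  a1 ≡ a2 + a3^k (mod p).

  -- exact 3-colouring: surjective onto {R,G,B}
  Surjective : (Fin p → Colour) → Set
  Surjective c = ∀ (col : Colour) → ∃[ x ] c x ≡ col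

  PairwiseDistinct : Colour → Colour → Colour → Set
  PairwiseDistinct u v w = u ≢ v × v ≢ w × u ≢ w

  RainbowFree : ℕ → (Fin p → Colour) → Set
  RainbowFree k c = ∀ (a₁ a₂ a₃ : Fin p) →
    toℕ a₁ ≡ (toℕ a₂ + toℕ a₃ ^ k) % p →
    ¬ PairwiseDistinct (c a₁) (c a₂) (c a₃)

  InString : ℕ → Fin p → Fin p → Fin p → Set
  InString d i ℓ x = ∃[ j ] (j < toℕ ℓ × toℕ x ≡ (((toℕ i + j) * d) % p))

  Occurs : (Fin p → Colour) → ℕ → Fin p → Fin p → Colour → Set
  Occurs c d i ℓ col = ∃[ x ] (InString d i ℓ x × c x ≡ col)

  Bichromatic : (Fin p → Colour) → ℕ → Fin p → Fin p → Set
  Bichromatic c d i ℓ =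
    ∃[ u ] ∃[ v ] ∃[ w ] (PairwiseDistinct u v w ×
      Occurs c d i ℓ u × Occurs c d i ℓ v × ¬ Occurs c d i ℓ w)

  Dominant : (Fin p → Colour) → ℕ → Colour → Set
  Dominant c d col = ∀ (i ℓ : Fin p) → Bichromatic c d i ℓ → Occurs c d i ℓ col

{-# OPTIONS --safe #-}
module Submission where

-- Walking along a bichromatic a^k-string from an element of one colour to an element of the
-- other, the colour changes between two neighbours x and x + a^k.  Then (x + a^k, x, a) solves
-- x - y = z^k, so rainbow-freeness forces one of the two neighbours to have colour c(a).
-- The argument uses none of: p prime, p ≠ 2, k ≥ 2, surjectivity, a ≠ 0.

open import Defs
open import Data.Nat using (ℕ; zero; suc; _+_; _*_; _^_; _≤_; _<_; NonZero; z≤n)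
open import Data.Nat.Properties
  using (≤-total; ≤-pred; ≤-<-trans; <-trans; m≤n⇒m<n∨m≡n; m<n⇒m<1+n; n<1+n; +-suc; +-comm)
open import Data.Nat.DivMod using (_%_; m%n<n; m%n%n≡m%n; %-distribˡ-+)
open import Data.Nat.Primality using (Prime)
open import Data.Fin using (Fin; toℕ; fromℕ<)
open import Data.Fin.Properties using (toℕ-fromℕ<; toℕ-injective)
open import Data.Product using (_×_; _,_; ∃-syntax; map₂; map₁)
open import Data.Sum using (_⊎_; inj₁; inj₂; [_,_]′)
open import Data.Empty using (⊥-elim)
open import Relation.Nullary using (yes; no)
open import Relation.Binary.Definitions using (DecidableEquality)
open import Relation.Binary.PropositionalEquality
  using (_≡_; _≢_; refl; sym; trans; cong; module ≡-Reasoning)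

_≟ᶜ_ : DecidableEquality Colour
R ≟ᶜ R = yes refl
R ≟ᶜ G = no λ ()
R ≟ᶜ B = no λ ()
G ≟ᶜ R = no λ ()
G ≟ᶜ G = yes refl
G ≟ᶜ B = no λ ()
B ≟ᶜ R = no λ ()
B ≟ᶜ G = no λ ()
B ≟ᶜ B = yes refl

[m%n+k]%n≡[m+k]%n : ∀ m k n .{{_ : NonZero n}} → (m % n + k) % n ≡ (m + k) % n
[m%n+k]%n≡[m+k]%n m k n = begin
  (m % n + k) % n          ≡⟨ %-distribˡ-+ (m % n) k n ⟩
  (m % n % n + k % n) % n  ≡⟨ cong (λ t → (t + k % n) % n) (m%n%n≡m%n m n) ⟩
  (m % n + k % n) % n      ≡⟨ %-distribˡ-+ m k n ⟨
  (m + k) % n              ∎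
  where open ≡-Reasoning

module _ {A : Set} (_≟_ : DecidableEquality A) (f : ℕ → A) where

  adjacent-change : ∀ {m n} → m ≤ n → f m ≢ f n → ∃[ j ] (j < n × f j ≢ f (suc j))
  adjacent-change {n = zero}  z≤n    fm≢fn = ⊥-elim (fm≢fn refl)
  adjacent-change {n = suc n} m≤1+n fm≢f1+n with m≤n⇒m<n∨m≡n m≤1+n
  ... | inj₂ refl = ⊥-elim (fm≢f1+n refl)
  ... | inj₁ m<1+n with f n ≟ f (suc n)
  ...   | no fn≢f1+n  = n , n<1+n n , fn≢f1+n
  ...   | yes fn≡f1+n =
    map₂ (map₁ m<n⇒m<1+n) (adjacent-change (≤-pred m<1+n) (λ fm≡fn → fm≢f1+n (trans fm≡fn fn≡f1+n)))

  adjacent-change-below : ∀ {m n ℓ} → m < ℓ → n < ℓ → f m ≢ f n →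
                          ∃[ j ] (suc j < ℓ × f j ≢ f (suc j))
  adjacent-change-below {m} {n} m<ℓ n<ℓ fm≢fn with ≤-total m n
  ... | inj₁ m≤n = map₂ (map₁ (λ j<n → ≤-<-trans j<n n<ℓ)) (adjacent-change m≤n fm≢fn)
  ... | inj₂ n≤m = map₂ (map₁ (λ j<m → ≤-<-trans j<m m<ℓ)) (adjacent-change n≤m (λ e → fm≢fn (sym e)))

module _ (p : ℕ) .{{_ : NonZero p}} where

  rainbowFree-neighbour : ∀ k {c} → RainbowFree p k c → (a x y : Fin p) →
                          toℕ y ≡ (toℕ x + toℕ a ^ k) % p → c y ≢ c x →
                          c y ≡ c a ⊎ c x ≡ c a
  rainbowFree-neighbour k {c} rf a x y y≡x+aᵏ cy≢cx with c y ≟ᶜ c a | c x ≟ᶜ c a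
  ... | yes cy≡ca | _         = inj₁ cy≡ca
  ... | no _      | yes cx≡ca = inj₂ cx≡ca
  ... | no cy≢ca  | no cx≢ca  = ⊥-elim (rf y x a y≡x+aᵏ (cy≢cx , cx≢ca , cy≢ca))

  module _ (d i : ℕ) where

    stringElem : ℕ → Fin p
    stringElem j = fromℕ< (m%n<n ((i + j) * d) p)

    stringElem-suc : ∀ j → toℕ (stringElem (suc j)) ≡ (toℕ (stringElem j) + d) % p
    stringElem-suc j = begin
      toℕ (stringElem (suc j))      ≡⟨ toℕ-fromℕ< _ ⟩
      ((i + suc j) * d) % p         ≡⟨ cong (λ t → (t * d) % p) (+-suc i j) ⟩
      (d + (i + j) * d) % p         ≡⟨ cong (_% p) (+-comm d ((i + j) * d)) ⟩
      ((i + j) * d + d) % p         ≡⟨ [m%n+k]%n≡[m+k]%n ((i + j) * d) d p ⟨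
      (((i + j) * d) % p + d) % p   ≡⟨ cong (λ t → (t + d) % p) (toℕ-fromℕ< _) ⟨
      (toℕ (stringElem j) + d) % p  ∎
      where open ≡-Reasoning

  module _ (c : Fin p → Colour) (d : ℕ) (i ℓ : Fin p) where

    occurs⇒index : ∀ {col} → Occurs p c d i ℓ col →
                   ∃[ j ] (j < toℕ ℓ × c (stringElem d (toℕ i) j) ≡ col)
    occurs⇒index (x , (j , j<ℓ , x≡) , cx≡col) =
      j , j<ℓ , trans (cong c (toℕ-injective (trans (toℕ-fromℕ< _) (sym x≡)))) cx≡col

    index⇒occurs : ∀ {j col} → j < toℕ ℓ → c (stringElem d (toℕ i) j) ≡ col → Occurs p c d i ℓ col
    index⇒occurs {j} j<ℓ cx≡col = stringElem d (toℕ i) j , (j , j<ℓ , toℕ-fromℕ< _) , cx≡col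

  rainbowFree⇒dominant : ∀ k {c} → RainbowFree p k c → (a : Fin p) → Dominant p c (toℕ a ^ k) (c a)
  rainbowFree⇒dominant k {c} rf a i ℓ (u , v , _ , (u≢v , _) , occ-u , occ-v , _) =
    let m , m<ℓ , cxm≡u = occurs⇒index c d i ℓ occ-u
        n , n<ℓ , cxn≡v = occurs⇒index c d i ℓ occ-v
        j , 1+j<ℓ , change =
          adjacent-change-below _≟ᶜ_ (λ j → c (x j)) m<ℓ n<ℓ (λ e → u≢v (trans (sym cxm≡u) (trans e cxn≡v)))
    in  [ index⇒occurs c d i ℓ 1+j<ℓ
        , index⇒occurs c d i ℓ (<-trans (n<1+n j) 1+j<ℓ)
        ]′ (rainbowFree-neighbour k rf a (x j) (x (suc j)) (stringElem-suc d (toℕ i) j) (λ e → change (sym e)))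
    where
    d : ℕ
    d = toℕ a ^ k
    x : ℕ → Fin p
    x = stringElem d (toℕ i)

mainTheorem16 : (p : ℕ) → .{{_ : NonZero p}} → Prime p → p ≢ 2 →
    (k : ℕ) → 2 ≤ k → (c : Fin p → Colour) →
    Surjective p c → RainbowFree p k c →
    (a : Fin p) → toℕ a ≢ 0 → Dominant p c (toℕ a ^ k) (c a)
mainTheorem16 p _ _ k _ _ _ rf a _ = rainbowFree⇒dominant p k rf a
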